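{- Let $m>n\ge1$ be coprime, $\alpha=\epsilon_i-\delta_j$, $k\in\mathbb Z$, $\beta=\nu^{ -k}(\alpha)$, and $\lambda\in X_{\pm\alpha}$. Then $x(\lambda,k)\in\Pi_{\pm\beta}$ and $x(t_{\pm\alpha}(\lambda),k)=\tau_{\pm\beta}(x(\lambda,k))$.
   Context: $X$: partitions $\lambda=(\lambda_1\ge\dots\ge\lambda_n\ge0)$ with $\lambda_1\le m$, drawn in the grid with rows $\epsilon_1,\dots,\epsilon_n$ (top to bottom) and columns $\delta_1,\dots,\delta_m$, with $\lambda_k$ left-justified boxes in row $\epsilon_{n+1-k}$; $\lambda'_j=|\{k:\lambda_k\ge j\}|$. $X_\alpha$ (resp. $X_{ -\alpha}$): those $\lambda$ for which box $\epsilon_i-\delta_j$ is an outer (resp. inner) corner; $t_\alpha$ adds and $t_{ -\alpha}$ removes it. Elements of $\mathbb Z^{n|m}$: $(a_1,\dots,a_n|b_1,\dots,b_m)=\sum a_p\epsilon_p-\sum b_q\delta_q$, with $(\Lambda,\epsilon_p-\delta_q)=a_p-b_q$. $x(\lambda)$ has $a_p=m(n-p)+n\lambda_{n+1-p}$, $b_q=n(q-1)+m\lambda'_q$. $\nu(a_1,\dots,a_n|b)=(a_n,a_1,\dots,a_{n-1}|b)$; on roots $\nu(\epsilon_p-\delta_q)=\epsilon_{p+1}-\delta_q$ (indices mod $n$ in $\{1,\dots,n\}$). $\mathbf m=(m,\dots,m|m,\dots,m)$, $x(\lambda,k)=\nu^{ -k}x(\lambda)+k\mathbf m$. For $\gamma=\epsilon_p-\delta_q$: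 $\Pi_\gamma=\{(\Lambda,\gamma)=0\}$, $\Pi_{ -\gamma}=\{(\Lambda,\gamma)=n-m\}$, $\tau_{\pm\gamma}(\Lambda)=\Lambda\pm(n\epsilon_p-m\delta_q)$. -}

module Defs where

open import Data.Nat as ℕ using (ℕ; zero; suc; _≤_; _≤?_)
open import Data.Nat.DivMod using (_mod_)
open import Data.Integer as ℤ using (ℤ; +_; -[1+_])
open import Data.Fin as Fin using (Fin; toℕ; opposite; _≟_)
open import Data.List using (List; length; filter)
open import Data.List.Base using (allFin)
open import Data.Product using (_×_; _,_)
open import Relation.Nullary using (does)
open import Data.Bool using (if_then_else_)
open import Relation.Binary.PropositionalEquality using (_≡_)

-- Conventions: all Fin indices are 0-based; index i : Fin n stands for the
-- 1-based index (toℕ i + 1).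

-- Partitions in the n × m box, as raw sequences
-- lam k  (k : Fin n) is  λ_{k+1}.

IsPartition : (n m : ℕ) → (Fin n → ℕ) → Set
IsPartition n m lam =
  ((k l : Fin n) → k Fin.≤ l → lam l ≤ lam k) × ((k : Fin n) → lam k ≤ m)

conj : {n : ℕ} → (Fin n → ℕ) → ℕ → ℕ
conj {n} lam q = length (filter (λ k → q ≤? lam k) (allFin n))

update : {n : ℕ} → (Fin n → ℕ) → Fin n → ℕ → (Fin n → ℕ)
update lam r v k = if does (k ≟ r) then v else lam k

-- Roots ε_i - δ_j, represented by (i , j) : Fin n × Fin m.
-- Row ε_{i} (1-based i) holds λ_{n+1-i} boxes; with 0-based i this is
-- the entry  lam (opposite i).  Box ε_i - δ_j lies in column j.

Root : ℕ → ℕ → Set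
Root n m = Fin n × Fin m

data Sign : Set where
  pos neg : Sign

-- length of row of α after adding (pos) / removing (neg) box α = (i , j):
-- adding box in column j (1-based j = toℕ j + 1) gives row length toℕ j + 1;
-- removing it gives row length toℕ j.
rowAfter : {m : ℕ} → Sign → Fin m → ℕ
rowAfter pos j = suc (toℕ j)
rowAfter neg j = toℕ j

rowBefore : {m : ℕ} → Sign → Fin m → ℕ
rowBefore pos j = toℕ j
rowBefore neg j = suc (toℕ j)

t : {n m : ℕ} → Sign → Root n m → (Fin n → ℕ) → (Fin n → ℕ)
t s (i , j) lam = update lam (opposite i) (rowAfter s j)

-- X_{α} (outer corner) / X_{-α} (inner corner): λ is a partition in the box,
-- the box α is not in λ and is addable (pos), resp. is in λ and removable (neg):
-- the row of α ends exactly before / at column j, and the modified diagram is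
-- again a partition in the n × m box.
X : (n m : ℕ) → Sign → Root n m → (Fin n → ℕ) → Set
X n m s (i , j) lam =
  IsPartition n m lam × (lam (opposite i) ≡ rowBefore s j)
  × IsPartition n m (t s (i , j) lam)

-- Z^{n|m}: (a_1..a_n | b_1..b_m) = Σ a_p ε_p - Σ b_q δ_q

record Elt (n m : ℕ) : Set where
  constructor ⟨_∣_⟩
  field
    a : Fin n → ℤ
    b : Fin m → ℤ
open Elt public

_≈E_ : {n m : ℕ} → Elt n m → Elt n m → Set
Λ ≈E Μ = ((p : _) → a Λ p ≡ a Μ p) × ((q : _) → b Λ q ≡ b Μ q)

pairing : {n m : ℕ} → Elt n m → Root n m → ℤ
pairing Λ (p , q) = a Λ p ℤ.- b Λ q

-- x(λ): a_p = m(n-p) + n λ_{n+1-p},  b_q = n(q-1) + m λ'_q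
x : (n m : ℕ) → (Fin n → ℕ) → Elt n m
x n m lam = ⟨ (λ p → + (m ℕ.* toℕ (opposite p) ℕ.+ n ℕ.* lam (opposite p)))
            ∣ (λ q → + (n ℕ.* toℕ q ℕ.+ m ℕ.* conj lam (suc (toℕ q)))) ⟩

csuc : {n : ℕ} → Fin n → Fin n
csuc {suc n} i = suc (toℕ i) mod suc n

cpred : {n : ℕ} → Fin n → Fin n
cpred {suc n} i = (toℕ i ℕ.+ n) mod suc n

ν : {n m : ℕ} → Elt n m → Elt n m
ν Λ = ⟨ (λ p → a Λ (cpred p)) ∣ b Λ ⟩

νinv : {n m : ℕ} → Elt n m → Elt n m
νinv Λ = ⟨ (λ p → a Λ (csuc p)) ∣ b Λ ⟩

νR : {n m : ℕ} → Root n m → Root n m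
νR (p , q) = (csuc p , q)

νRinv : {n m : ℕ} → Root n m → Root n m
νRinv (p , q) = (cpred p , q)

iter : {A : Set} → (A → A) → ℕ → A → A
iter f zero    y = y
iter f (suc k) y = f (iter f k y)

νpow : {n m : ℕ} → ℤ → Elt n m → Elt n m
νpow (+ k)     = iter ν k
νpow -[1+ k ]  = iter νinv (suc k)

νRpow : {n m : ℕ} → ℤ → Root n m → Root n m
νRpow (+ k)     = iter νR k
νRpow -[1+ k ]  = iter νRinv (suc k)

xk : (n m : ℕ) → (Fin n → ℕ) → ℤ → Elt n m
xk n m lam k =
  let Λ = νpow (ℤ.- k) (x n m lam) in
  ⟨ (λ p → a Λ p ℤ.+ k ℤ.* + m) ∣ (λ q → b Λ q ℤ.+ k ℤ.* + m) ⟩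

Π : (n m : ℕ) → Sign → Root n m → Elt n m → Set
Π n m pos γ Λ = pairing Λ γ ≡ + 0
Π n m neg γ Λ = pairing Λ γ ≡ + n ℤ.- + m

shift : Sign → ℕ → ℤ
shift pos c = + c
shift neg c = ℤ.- + c

τ : (n m : ℕ) → Sign → Root n m → Elt n m → Elt n m
τ n m s (p , q) Λ =
  ⟨ (λ p' → if does (p' ≟ p) then a Λ p' ℤ.+ shift s n else a Λ p')
  ∣ (λ q' → if does (q' ≟ q) then b Λ q' ℤ.+ shift s m else b Λ q') ⟩

module Submission where

-- Adding the box ε_i − δ_j raises the row
-- length λ_{n+1−i} by one, hence a_i by n, and the column length λ′_j by one, hence
-- b_j by m; at an outer corner a_i = b_j = m(n−i) + n(j−1), and removing a box is the
-- inverse step, which lands in Π_{−α}. For general k, x(λ,k) is the image of x(λ)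
-- under ν^{−k} followed by a translation along 𝐦; both maps carry the pairing with γ
-- to the pairing with ν^{−k}γ (resp. γ) and intertwine the corresponding τ's.

open import Data.Bool using (true; false; if_then_else_)
open import Data.Empty using (⊥-elim)
open import Data.Fin as Fin using (Fin; toℕ; opposite; _≟_)
open import Data.Fin.Properties using (toℕ-injective; toℕ-fromℕ<; toℕ<n; opposite-involutive)
open import Data.Integer as ℤ using (ℤ; +_)
import Data.Integer.Properties as ℤₚ
open import Data.Integer.Tactic.RingSolver using (solve-∀)
open import Data.List using (length; filter; tabulate; allFin)
open import Data.List.Properties using (filter-accept; filter-reject; filter-≐)
open import Data.Nat as ℕ using (ℕ; zero; suc; _≤_; _<_; _≤?_; z≤n; s≤s; s<s; s<s⁻¹; NonZero)
open import Data.Nat.Coprimality using (Coprime)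
open import Data.Nat.DivMod using (_%_; _mod_; m%n<n; m%n%n≡m%n; %-distribˡ-+; [m+n]%n≡m%n; m<n⇒m%n≡m)
import Data.Nat.Properties as ℕₚ
open import Data.Product using (_×_; _,_; proj₁; proj₂)
open import Function using (_∘_; id; _⇔_; mk⇔; Equivalence)
open import Relation.Nullary using (does; yes; no)
open import Relation.Nullary.Decidable using (does-⇔; dec-true; dec-false)
open import Relation.Unary using (Pred; Decidable)
open import Relation.Binary.PropositionalEquality
open ≡-Reasoning

open import Defs

[m%d+n]%d≡[m+n]%d : ∀ m n d .{{_ : NonZero d}} → (m % d ℕ.+ n) % d ≡ (m ℕ.+ n) % d
[m%d+n]%d≡[m+n]%d m n d = begin
  (m % d ℕ.+ n) % d          ≡⟨ %-distribˡ-+ (m % d) n d ⟩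
  (m % d % d ℕ.+ n % d) % d  ≡⟨ cong (λ z → (z ℕ.+ n % d) % d) (m%n%n≡m%n m d) ⟩
  (m % d ℕ.+ n % d) % d      ≡⟨ %-distribˡ-+ m n d ⟨
  (m ℕ.+ n) % d              ∎

[m+n%d]%d≡[m+n]%d : ∀ m n d .{{_ : NonZero d}} → (m ℕ.+ n % d) % d ≡ (m ℕ.+ n) % d
[m+n%d]%d≡[m+n]%d m n d = begin
  (m ℕ.+ n % d) % d  ≡⟨ cong (_% d) (ℕₚ.+-comm m (n % d)) ⟩
  (n % d ℕ.+ m) % d  ≡⟨ [m%d+n]%d≡[m+n]%d n m d ⟩
  (n ℕ.+ m) % d      ≡⟨ cong (_% d) (ℕₚ.+-comm n m) ⟩
  (m ℕ.+ n) % d      ∎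

toℕ-mod : ∀ m d .{{_ : NonZero d}} → toℕ (m mod d) ≡ m % d
toℕ-mod m d = toℕ-fromℕ< (m%n<n m d)

[i+1+n]%[1+n]≡i : ∀ {n} (i : Fin (suc n)) → suc (toℕ i ℕ.+ n) % suc n ≡ toℕ i
[i+1+n]%[1+n]≡i {n} i = begin
  suc (toℕ i ℕ.+ n) % suc n  ≡⟨ cong (_% suc n) (ℕₚ.+-suc (toℕ i) n) ⟨
  (toℕ i ℕ.+ suc n) % suc n  ≡⟨ [m+n]%n≡m%n (toℕ i) (suc n) ⟩
  toℕ i % suc n              ≡⟨ m<n⇒m%n≡m (toℕ<n i) ⟩
  toℕ i                      ∎

cpred-csuc : ∀ {n} (i : Fin n) → cpred (csuc i) ≡ i
cpred-csuc {suc n} i = toℕ-injective (begin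
  toℕ (cpred (csuc i))                 ≡⟨ toℕ-mod (toℕ (csuc i) ℕ.+ n) (suc n) ⟩
  (toℕ (csuc i) ℕ.+ n) % suc n         ≡⟨ cong (λ z → (z ℕ.+ n) % suc n) (toℕ-mod (suc (toℕ i)) (suc n)) ⟩
  (suc (toℕ i) % suc n ℕ.+ n) % suc n  ≡⟨ [m%d+n]%d≡[m+n]%d (suc (toℕ i)) n (suc n) ⟩
  suc (toℕ i ℕ.+ n) % suc n            ≡⟨ [i+1+n]%[1+n]≡i i ⟩
  toℕ i                                ∎)

csuc-cpred : ∀ {n} (i : Fin n) → csuc (cpred i) ≡ i
csuc-cpred {suc n} i = toℕ-injective (begin
  toℕ (csuc (cpred i))               ≡⟨ toℕ-mod (suc (toℕ (cpred i))) (suc n) ⟩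
  suc (toℕ (cpred i)) % suc n        ≡⟨ cong (λ z → suc z % suc n) (toℕ-mod (toℕ i ℕ.+ n) (suc n)) ⟩
  (1 ℕ.+ (toℕ i ℕ.+ n) % suc n) % suc n ≡⟨ [m+n%d]%d≡[m+n]%d 1 (toℕ i ℕ.+ n) (suc n) ⟩
  suc (toℕ i ℕ.+ n) % suc n          ≡⟨ [i+1+n]%[1+n]≡i i ⟩
  toℕ i                              ∎)

≈E-refl : ∀ {n m} {Λ : Elt n m} → Λ ≈E Λ
≈E-refl = (λ _ → refl) , (λ _ → refl)

≈E-trans : ∀ {n m} {Λ Μ Ν : Elt n m} → Λ ≈E Μ → Μ ≈E Ν → Λ ≈E Ν
≈E-trans (ea , eb) (ea′ , eb′) = (λ p → trans (ea p) (ea′ p)) , (λ q → trans (eb q) (eb′ q))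

record IsSymmetry {n m : ℕ} (f : Elt n m → Elt n m) (g : Root n m → Root n m) : Set where
  field
    pairing-invariant : ∀ Λ γ → pairing (f Λ) (g γ) ≡ pairing Λ γ
    cong-≈E           : ∀ {Λ Μ} → Λ ≈E Μ → f Λ ≈E f Μ
    τ-equivariant     : ∀ s γ Λ → f (τ n m s γ Λ) ≈E τ n m s (g γ) (f Λ)

  Π-invariant : ∀ s γ Λ → Π n m s γ Λ → Π n m s (g γ) (f Λ)
  Π-invariant pos γ Λ = trans (pairing-invariant Λ γ)
  Π-invariant neg γ Λ = trans (pairing-invariant Λ γ)

open IsSymmetry

id-isSymmetry : ∀ {n m} → IsSymmetry {n} {m} id id
id-isSymmetry = record
  { pairing-invariant = λ _ _ → refl
  ; cong-≈E           = id
  ; τ-equivariant     = λ _ _ _ → ≈E-refl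
  }

∘-isSymmetry : ∀ {n m} {f f′ : Elt n m → Elt n m} {g g′ : Root n m → Root n m} →
               IsSymmetry f g → IsSymmetry f′ g′ → IsSymmetry (f′ ∘ f) (g′ ∘ g)
∘-isSymmetry S S′ = record
  { pairing-invariant = λ Λ γ → trans (pairing-invariant S′ _ _) (pairing-invariant S Λ γ)
  ; cong-≈E           = cong-≈E S′ ∘ cong-≈E S
  ; τ-equivariant     = λ s γ Λ →
      ≈E-trans (cong-≈E S′ (τ-equivariant S s γ Λ)) (τ-equivariant S′ s _ _)
  }

iter-isSymmetry : ∀ {n m} {f : Elt n m → Elt n m} {g : Root n m → Root n m} →
                  IsSymmetry f g → ∀ k → IsSymmetry (iter f k) (iter g k)
iter-isSymmetry S zero    = id-isSymmetry
iter-isSymmetry S (suc k) = ∘-isSymmetry (iter-isSymmetry S k) S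

module _ {n m : ℕ} (φ ψ : Fin n → Fin n)
         (φ∘ψ≗id : ∀ i → φ (ψ i) ≡ i) (ψ∘φ≗id : ∀ i → ψ (φ i) ≡ i) where

  reindex-isSymmetry :
    IsSymmetry {n} {m} (λ Λ → ⟨ a Λ ∘ φ ∣ b Λ ⟩) (λ γ → ψ (proj₁ γ) , proj₂ γ)
  reindex-isSymmetry = record
    { pairing-invariant = λ Λ (p , q) → cong (λ p′ → a Λ p′ ℤ.- b Λ q) (φ∘ψ≗id p)
    ; cong-≈E           = λ (ea , eb) → ea ∘ φ , eb
    ; τ-equivariant     = λ s (p , q) Λ →
        (λ p′ → cong (λ d → if d then a Λ (φ p′) ℤ.+ shift s n else a Λ (φ p′))
                     (does-⇔ (transpose p′ p) (φ p′ ≟ p) (p′ ≟ ψ p)))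
        , (λ _ → refl)
    }
    where
    transpose : ∀ p′ p → (φ p′ ≡ p) ⇔ (p′ ≡ ψ p)
    transpose p′ p = mk⇔ (λ e → trans (sym (ψ∘φ≗id p′)) (cong ψ e))
                         (λ e → trans (cong φ e) (φ∘ψ≗id p))

ν-isSymmetry : ∀ {n m} → IsSymmetry {n} {m} ν νR
ν-isSymmetry = reindex-isSymmetry cpred csuc cpred-csuc csuc-cpred

νinv-isSymmetry : ∀ {n m} → IsSymmetry {n} {m} νinv νRinv
νinv-isSymmetry = reindex-isSymmetry csuc cpred csuc-cpred cpred-csuc

νpow-isSymmetry : ∀ {n m} z → IsSymmetry {n} {m} (νpow z) (νRpow z)
νpow-isSymmetry (+ k)      = iter-isSymmetry ν-isSymmetry k
νpow-isSymmetry ℤ.-[1+ k ] = iter-isSymmetry νinv-isSymmetry (suc k)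

translate : ∀ {n m} → ℤ → Elt n m → Elt n m
translate c Λ = ⟨ (λ p → a Λ p ℤ.+ c) ∣ (λ q → b Λ q ℤ.+ c) ⟩

translate-isSymmetry : ∀ {n m} c → IsSymmetry {n} {m} (translate c) id
translate-isSymmetry c = record
  { pairing-invariant = λ Λ (p , q) → [x+c]-[y+c]≡x-y (a Λ p) (b Λ q) c
  ; cong-≈E           = λ (ea , eb) → cong (ℤ._+ c) ∘ ea , cong (ℤ._+ c) ∘ eb
  ; τ-equivariant     = λ _ (p , q) _ → (λ p′ → if-+ (does (p′ ≟ p)) _ _)
                                       , (λ q′ → if-+ (does (q′ ≟ q)) _ _)
  }
  where
  [x+c]-[y+c]≡x-y : ∀ x y c → (x ℤ.+ c) ℤ.- (y ℤ.+ c) ≡ x ℤ.- y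
  [x+c]-[y+c]≡x-y = solve-∀
  [x+y]+c≡[x+c]+y : ∀ x y c → (x ℤ.+ y) ℤ.+ c ≡ (x ℤ.+ c) ℤ.+ y
  [x+y]+c≡[x+c]+y = solve-∀
  if-+ : ∀ d x y → (if d then x ℤ.+ y else x) ℤ.+ c ≡ (if d then (x ℤ.+ c) ℤ.+ y else x ℤ.+ c)
  if-+ true  x y = [x+y]+c≡[x+c]+y x y c
  if-+ false x y = refl

length-filter-tabulate : ∀ {ℓ p} {A : Set ℓ} {P : Pred A p} (P? : Decidable P) {n c}
                         (f : Fin n → A) → c ≤ n → (∀ k → P (f k) ⇔ toℕ k < c) →
                         length (filter P? (tabulate f)) ≡ c
length-filter-tabulate P? {zero}  f z≤n       P⇔ = refl
length-filter-tabulate P? {suc n} {zero} f z≤n P⇔ = begin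
  length (filter P? (tabulate f))
    ≡⟨ cong length (filter-reject P? (ℕₚ.n≮0 ∘ to (P⇔ Fin.zero))) ⟩
  length (filter P? (tabulate (f ∘ Fin.suc)))
    ≡⟨ length-filter-tabulate P? (f ∘ Fin.suc) z≤n
         (λ k → mk⇔ (⊥-elim ∘ ℕₚ.n≮0 ∘ to (P⇔ (Fin.suc k))) λ ()) ⟩
  0 ∎
  where open Equivalence
length-filter-tabulate P? {suc n} {suc c} f (s≤s c≤n) P⇔ = begin
  length (filter P? (tabulate f))
    ≡⟨ cong length (filter-accept P? (from (P⇔ Fin.zero) (s≤s z≤n))) ⟩
  suc (length (filter P? (tabulate (f ∘ Fin.suc))))
    ≡⟨ cong suc (length-filter-tabulate P? (f ∘ Fin.suc) c≤n
         (λ k → mk⇔ (s<s⁻¹ ∘ to (P⇔ (Fin.suc k))) (from (P⇔ (Fin.suc k)) ∘ s<s))) ⟩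
  suc c ∎
  where open Equivalence

opposite-≢ : ∀ {n} {p i : Fin n} → p ≢ i → opposite p ≢ opposite i
opposite-≢ {p = p} {i} p≢i e = p≢i (begin
  p                       ≡⟨ opposite-involutive p ⟨
  opposite (opposite p)   ≡⟨ cong opposite e ⟩
  opposite (opposite i)   ≡⟨ opposite-involutive i ⟩
  i                       ∎)

update-same : ∀ {n} (lam : Fin n → ℕ) r v → update lam r v r ≡ v
update-same lam r v rewrite dec-true (r ≟ r) refl = refl

update-other : ∀ {n} (lam : Fin n → ℕ) {r} v k → k ≢ r → update lam r v k ≡ lam k
update-other lam {r} v k k≢r rewrite dec-false (k ≟ r) k≢r = refl

+[x+c*suc[j]]≡+[x+c*j]+c : ∀ x c j → + (x ℕ.+ c ℕ.* suc j) ≡ + (x ℕ.+ c ℕ.* j) ℤ.+ + c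
+[x+c*suc[j]]≡+[x+c*j]+c x c j = begin
  + (x ℕ.+ c ℕ.* suc j)       ≡⟨ cong (λ z → + (x ℕ.+ z)) (ℕₚ.*-suc c j) ⟩
  + (x ℕ.+ (c ℕ.+ c ℕ.* j))   ≡⟨ cong (λ z → + (x ℕ.+ z)) (ℕₚ.+-comm c (c ℕ.* j)) ⟩
  + (x ℕ.+ (c ℕ.* j ℕ.+ c))   ≡⟨ cong +_ (ℕₚ.+-assoc x (c ℕ.* j) c) ⟨
  + (x ℕ.+ c ℕ.* j ℕ.+ c)     ≡⟨ ℤₚ.pos-+ (x ℕ.+ c ℕ.* j) c ⟩
  + (x ℕ.+ c ℕ.* j) ℤ.+ + c   ∎

module AddBox {n m : ℕ} (μ ν′ : Fin n → ℕ) (i : Fin n) (j : Fin m)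
  (μ-antitone  : ∀ k l → k Fin.≤ l → μ l ≤ μ k)
  (ν′-antitone : ∀ k l → k Fin.≤ l → ν′ l ≤ ν′ k)
  (μ-row  : μ (opposite i) ≡ toℕ j)
  (ν′-row : ν′ (opposite i) ≡ suc (toℕ j))
  (μ≡ν′   : ∀ k → k ≢ opposite i → μ k ≡ ν′ k) where

  private
    r : Fin n
    r = opposite i

    <⇒≢r : ∀ {k} → toℕ k < toℕ r → k ≢ r
    <⇒≢r k<r refl = ℕₚ.<-irrefl refl k<r

    >⇒≢r : ∀ {k} → toℕ r < toℕ k → k ≢ r
    >⇒≢r r<k refl = ℕₚ.<-irrefl refl r<k

  conj-μ-row : conj μ (suc (toℕ j)) ≡ toℕ r
  conj-μ-row = length-filter-tabulate (λ k → suc (toℕ j) ≤? μ k) id (ℕₚ.<⇒≤ (toℕ<n r)) λ k → mk⇔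
    (λ j<μk → ℕₚ.≰⇒> λ r≤k → ℕₚ.<-irrefl refl
      (ℕₚ.≤-trans j<μk (subst (μ k ≤_) μ-row (μ-antitone r k r≤k))))
    (λ k<r → subst (_≤ μ k) ν′-row
      (subst (ν′ r ≤_) (sym (μ≡ν′ k (<⇒≢r k<r))) (ν′-antitone k r (ℕₚ.<⇒≤ k<r))))

  conj-ν′-row : conj ν′ (suc (toℕ j)) ≡ suc (toℕ r)
  conj-ν′-row = length-filter-tabulate (λ k → suc (toℕ j) ≤? ν′ k) id (toℕ<n r) λ k → mk⇔
    (λ j<ν′k → s≤s (ℕₚ.≮⇒≥ λ r<k → ℕₚ.<-irrefl refl (ℕₚ.≤-trans j<ν′k
      (subst (_≤ toℕ j) (μ≡ν′ k (>⇒≢r r<k))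
        (subst (μ k ≤_) μ-row (μ-antitone r k (ℕₚ.<⇒≤ r<k)))))))
    (λ k≤r → subst (_≤ ν′ k) ν′-row (ν′-antitone k r (ℕₚ.≤-pred k≤r)))

  conj-other : ∀ q → q ≢ toℕ j → conj μ (suc q) ≡ conj ν′ (suc q)
  conj-other q q≢j = cong length (filter-≐ (λ k → suc q ≤? μ k) (λ k → suc q ≤? ν′ k)
                                   ((λ {k} → to (same k)) , (λ {k} → from (same k))) (allFin n))
    where
    open Equivalence
    same : ∀ k → (suc q ≤ μ k) ⇔ (suc q ≤ ν′ k)
    same k with k ≟ r
    ... | no k≢r   = mk⇔ (subst (suc q ≤_) (μ≡ν′ k k≢r)) (subst (suc q ≤_) (sym (μ≡ν′ k k≢r)))
    ... | yes refl = mk⇔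
      (λ q<μr → subst (suc q ≤_) (sym ν′-row) (ℕₚ.m≤n⇒m≤1+n (subst (suc q ≤_) μ-row q<μr)))
      (λ q<ν′r → subst (suc q ≤_) (sym μ-row)
        (ℕₚ.≤∧≢⇒< (ℕₚ.≤-pred (subst (suc q ≤_) ν′-row q<ν′r)) q≢j))

  x-Π : Π n m pos (i , j) (x n m μ)
  x-Π rewrite μ-row | conj-μ-row =
    trans (cong (λ z → + (m ℕ.* toℕ r ℕ.+ n ℕ.* toℕ j) ℤ.- + z)
                (ℕₚ.+-comm (n ℕ.* toℕ j) (m ℕ.* toℕ r)))
          (ℤₚ.+-inverseʳ (+ (m ℕ.* toℕ r ℕ.+ n ℕ.* toℕ j)))

  x-addBox : x n m ν′ ≈E τ n m pos (i , j) (x n m μ)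
  x-addBox = a-addBox , b-addBox
    where
    a-addBox : ∀ p → a (x n m ν′) p ≡ a (τ n m pos (i , j) (x n m μ)) p
    a-addBox p with p ≟ i
    ... | yes refl rewrite μ-row | ν′-row = +[x+c*suc[j]]≡+[x+c*j]+c (m ℕ.* toℕ r) n (toℕ j)
    ... | no p≢i   = cong (λ z → + (m ℕ.* toℕ (opposite p) ℕ.+ n ℕ.* z))
                          (sym (μ≡ν′ _ (opposite-≢ p≢i)))
    b-addBox : ∀ q → b (x n m ν′) q ≡ b (τ n m pos (i , j) (x n m μ)) q
    b-addBox q with q ≟ j
    ... | yes refl rewrite conj-μ-row | conj-ν′-row =
      +[x+c*suc[j]]≡+[x+c*j]+c (n ℕ.* toℕ j) m (toℕ r)
    ... | no q≢j   = cong (λ z → + (n ℕ.* toℕ q ℕ.+ m ℕ.* z))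
                          (sym (conj-other (toℕ q) (q≢j ∘ toℕ-injective)))

module _ {n m : ℕ} (p : Fin n) (q : Fin m) where

  a-τ-at : ∀ s Λ → a (τ n m s (p , q) Λ) p ≡ a Λ p ℤ.+ shift s n
  a-τ-at s Λ rewrite dec-true (p ≟ p) refl = refl

  b-τ-at : ∀ s Λ → b (τ n m s (p , q) Λ) q ≡ b Λ q ℤ.+ shift s m
  b-τ-at s Λ rewrite dec-true (q ≟ q) refl = refl

  τ-pos⇒τ-neg : ∀ {Λ Λ′} → Λ′ ≈E τ n m pos (p , q) Λ → Λ ≈E τ n m neg (p , q) Λ′
  τ-pos⇒τ-neg (ea , eb) =
    (λ p′ → undo (does (p′ ≟ p)) (ea p′)) , (λ q′ → undo (does (q′ ≟ q)) (eb q′))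
    where
    x≡[x+c]-c : ∀ x c → x ≡ (x ℤ.+ c) ℤ.- c
    x≡[x+c]-c = solve-∀
    undo : ∀ d {c x x′} → x′ ≡ (if d then x ℤ.+ + c else x) → x ≡ (if d then x′ ℤ.- + c else x′)
    undo true  {c} {x} e = trans (x≡[x+c]-c x (+ c)) (cong (ℤ._- + c) (sym e))
    undo false e = sym e

  Π-pos⇒Π-neg : ∀ {Λ Λ′} → Λ′ ≈E τ n m pos (p , q) Λ →
                Π n m pos (p , q) Λ → Π n m neg (p , q) Λ′
  Π-pos⇒Π-neg {Λ} {Λ′} (ea , eb) Λ∈Π = begin
    a Λ′ p ℤ.- b Λ′ q
      ≡⟨ cong₂ ℤ._-_ (trans (ea p) (a-τ-at pos Λ)) (trans (eb q) (b-τ-at pos Λ)) ⟩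
    (a Λ p ℤ.+ + n) ℤ.- (b Λ q ℤ.+ + m)   ≡⟨ regroup (a Λ p) (b Λ q) (+ n) (+ m) ⟩
    (a Λ p ℤ.- b Λ q) ℤ.+ (+ n ℤ.- + m)   ≡⟨ cong (ℤ._+ (+ n ℤ.- + m)) Λ∈Π ⟩
    + 0 ℤ.+ (+ n ℤ.- + m)                 ≡⟨ ℤₚ.+-identityˡ (+ n ℤ.- + m) ⟩
    + n ℤ.- + m                           ∎
    where
    regroup : ∀ x y u v → (x ℤ.+ u) ℤ.- (y ℤ.+ v) ≡ (x ℤ.- y) ℤ.+ (u ℤ.- v)
    regroup = solve-∀

x∈Π×x-t≈τ : ∀ {n m} s (α : Root n m) lam → X n m s α lam →
            Π n m s α (x n m lam) × (x n m (t s α lam) ≈E τ n m s α (x n m lam))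
x∈Π×x-t≈τ pos (i , j) lam ((lam-antitone , _) , row , (t-antitone , _)) = x-Π , x-addBox
  where
  open AddBox lam (t pos (i , j) lam) i j lam-antitone t-antitone row
              (update-same lam (opposite i) _) (λ k k≢r → sym (update-other lam _ k k≢r))
x∈Π×x-t≈τ neg (i , j) lam ((lam-antitone , _) , row , (t-antitone , _)) =
  Π-pos⇒Π-neg i j x-addBox x-Π , τ-pos⇒τ-neg i j x-addBox
  where
  open AddBox (t neg (i , j) lam) lam i j t-antitone lam-antitone
              (update-same lam (opposite i) _) row (λ k k≢r → update-other lam _ k k≢r)

lemma4p13 : (n m : ℕ) → 1 ≤ n → n < m → Coprime m n →
    (α : Root n m) (k : ℤ) (s : Sign) (lam : Fin n → ℕ) →
    X n m s α lam →
    Π n m s (νRpow (ℤ.- k) α) (xk n m lam k)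
    × (xk n m (t s α lam) k ≈E τ n m s (νRpow (ℤ.- k) α) (xk n m lam k))
lemma4p13 n m _ _ _ α k s lam λ∈X with x∈Π×x-t≈τ s α lam λ∈X
... | x∈Π , x-t≈τ =
    Π-invariant S s α (x n m lam) x∈Π
  , ≈E-trans (cong-≈E S x-t≈τ) (τ-equivariant S s α (x n m lam))
  where
  S : IsSymmetry (translate (k ℤ.* + m) ∘ νpow (ℤ.- k)) (id ∘ νRpow (ℤ.- k))
  S = ∘-isSymmetry (νpow-isSymmetry (ℤ.- k)) (translate-isSymmetry (k ℤ.* + m))
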